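{- For every connected graph $G$ there is a global amoeba $H$ having a connected component isomorphic to $G$.
   Context: For a graph $G$ on vertex set $V=\{v_1,\dots,v_n\}$ let $L_G=\{ij: v_iv_j\in E(G)\}$; for $\sigma\in S_n$, $G_\sigma$ is the graph on $V$ with $E(G_\sigma)=\{v_{\sigma^{ -1}(i)}v_{\sigma^{ -1}(j)}: ij\in L_G\}$. An edge-replacement $e\to e'$ ($e\in E(G)$, $e'\in E(\overline G)\cup\{e\}$) is feasible if $G-e+e'\cong G$. Let $R_G$ be the set of feasible replacements $rs\to kl$ (meaning $v_rv_s\to v_kv_l$), $S_G(rs\to kl)=\{\sigma\in S_n: G_\sigma=G-v_rv_s+v_kv_l\}$, and $S_G\le S_n$ the group generated by $\bigcup_{rs\to kl\in R_G}S_G(rs\to kl)$. $G$ is a local amoeba if $S_G=S_n$; $G$ is a global amoeba if there is $T\ge0$ such that $G\cup tK_1$ ($G$ plus $t$ isolated vertices) is a local amoeba for all $t\ge T$. -}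

module Defs where

open import Data.Nat using (ℕ; zero; suc; _+_; _≤_)
open import Data.Fin using (Fin; splitAt; _≟_)
open import Data.Fin.Permutation using (Permutation′; _⟨$⟩ʳ_; _∘ₚ_; flip; id)
open import Data.Bool using (Bool; true; false; if_then_else_; _∧_; _∨_)
open import Data.Sum using (_⊎_; inj₁; inj₂)
open import Data.Product using (Σ; ∃; ∃-syntax; _×_; _,_)
open import Relation.Nullary using (¬_)
open import Relation.Nullary.Decidable using (⌊_⌋)
open import Relation.Binary.PropositionalEquality using (_≡_)
open import Function.Definitions using (Injective)

record Graph (n : ℕ) : Set where
  field
    adj    : Fin n → Fin n → Bool
    sym    : ∀ i j → adj i j ≡ adj j i
    irrefl : ∀ i → adj i i ≡ false
open Graph public

Adj : ℕ → Set
Adj n = Fin n → Fin n → Bool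

_≐_ : ∀ {n} → Adj n → Adj n → Set
A ≐ B = ∀ a b → A a b ≡ B a b

permuted : ∀ {n} → Graph n → Permutation′ n → Adj n
permuted G σ a b = adj G (σ ⟨$⟩ʳ a) (σ ⟨$⟩ʳ b)

samePair : ∀ {n} → Fin n → Fin n → Fin n → Fin n → Bool
samePair a b r s = (⌊ a ≟ r ⌋ ∧ ⌊ b ≟ s ⌋) ∨ (⌊ a ≟ s ⌋ ∧ ⌊ b ≟ r ⌋)

replace : ∀ {n} → Graph n → Fin n → Fin n → Fin n → Fin n → Adj n
replace G r s k l a b =
  if samePair a b k l then true
  else (if samePair a b r s then false else adj G a b)

IsoAdj : ∀ {n} → Adj n → Adj n → Set
IsoAdj {n} A B = Σ (Permutation′ n) λ π → ∀ a b → B (π ⟨$⟩ʳ a) (π ⟨$⟩ʳ b) ≡ A a b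

IsReplacement : ∀ {n} → Graph n → Fin n → Fin n → Fin n → Fin n → Set
IsReplacement G r s k l =
  adj G r s ≡ true ×
  ((adj G k l ≡ false × ¬ (k ≡ l)) ⊎ samePair k l r s ≡ true)

Feasible : ∀ {n} → Graph n → Fin n → Fin n → Fin n → Fin n → Set
Feasible G r s k l = IsReplacement G r s k l × IsoAdj (replace G r s k l) (adj G)

Generator : ∀ {n} → Graph n → Permutation′ n → Set
Generator {n} G σ =
  ∃[ r ] ∃[ s ] ∃[ k ] ∃[ l ]
    (Feasible G r s k l × permuted G σ ≐ replace G r s k l)

-- S_G : the subgroup of S_n generated by the generators above
-- (permutations compared extensionally).
data InS {n : ℕ} (G : Graph n) : Permutation′ n → Set where
  gen  : ∀ {σ} → Generator G σ → InS G σ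
  one  : InS G id
  comp : ∀ {σ τ} → InS G σ → InS G τ → InS G (σ ∘ₚ τ)
  inv  : ∀ {σ} → InS G σ → InS G (flip σ)
  ext  : ∀ {σ τ} → InS G σ → (∀ i → σ ⟨$⟩ʳ i ≡ τ ⟨$⟩ʳ i) → InS G τ

LocalAmoeba : ∀ {n} → Graph n → Set
LocalAmoeba {n} G = ∀ (π : Permutation′ n) → InS G π

addIsolated : ∀ {n} → Graph n → (t : ℕ) → Graph (n + t)
addIsolated {n} G t = record { adj = A ; sym = S ; irrefl = I }
  where
    A : Fin (n + t) → Fin (n + t) → Bool
    A a b with splitAt n a | splitAt n b
    ... | inj₁ a′ | inj₁ b′ = adj G a′ b′
    ... | inj₁ _  | inj₂ _  = false
    ... | inj₂ _  | inj₁ _  = false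
    ... | inj₂ _  | inj₂ _  = false
    S : ∀ i j → A i j ≡ A j i
    S a b with splitAt n a | splitAt n b
    ... | inj₁ a′ | inj₁ b′ = sym G a′ b′
    ... | inj₁ _  | inj₂ _  = _≡_.refl
    ... | inj₂ _  | inj₁ _  = _≡_.refl
    ... | inj₂ _  | inj₂ _  = _≡_.refl
    I : ∀ i → A i i ≡ false
    I a with splitAt n a
    ... | inj₁ a′ = irrefl G a′
    ... | inj₂ _  = _≡_.refl

GlobalAmoeba : ∀ {n} → Graph n → Set
GlobalAmoeba G = ∃[ T ] (∀ t → T ≤ t → LocalAmoeba (addIsolated G t))

data Reach {n : ℕ} (G : Graph n) : Fin n → Fin n → Set where
  here : ∀ {x} → Reach G x x
  step : ∀ {x y z} → adj G x y ≡ true → Reach G y z → Reach G x z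

-- Connected graph (vertex set nonempty is imposed separately).
Connected : ∀ {n} → Graph n → Set
Connected G = ∀ x y → Reach G x y

HasComponentIso : ∀ {m n} → Graph m → Graph n → Set
HasComponentIso {m} {n} H G =
  ∃[ x ] Σ (Fin n → Fin m) λ f →
    Injective _≡_ _≡_ f ×
    (∀ a b → adj H (f a) (f b) ≡ adj G a b) ×
    (∀ y → Reach H x y → ∃[ a ] f a ≡ y) ×
    (∀ a → Reach H x (f a))

module Submission where

-- Let Q = G ⊕ K₂ (the K₂ only guarantees that Q has an edge) on N vertices,
-- and list the unordered pairs of Fin N by codes 0, …, P − 1, P = N·N.  The
-- telescope H of Q consists of P + 1 disjoint layers; layer k is a copy of
-- Fin N carrying the edges of Q of code < k.  So layer 0 is edgeless, layer P
-- is a copy of Q, and layers i and i + 1 differ at most in the edge of code i.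
-- In H ∪ (t + 1)K₁, exchanging layers i and i + 1 either is an automorphism or
-- realises the feasible replacement of that edge in layer i + 1 by its copy in
-- layer i; in both cases it lies in the group S.  Fix one of the K₁'s, w.
-- Transpositions (v w) with v isolated (in layer 0 or among the K₁'s) are
-- automorphisms; conjugating by the layer exchanges moves them up through all
-- layers.  Transpositions through one point generate S_n, so H is a global
-- amoeba with T = 1, and the layer-P copy of G is a component of H.

open import Defs
open import Data.Nat using (ℕ; suc)
open import Data.Product using (Σ; ∃; ∃-syntax; _×_)

open import Data.Nat using (zero; _+_; _*_)
open import Data.Nat.Properties using (_<?_)
import Data.Nat.Properties as NP
open import Data.Product using (_,_; proj₁; proj₂)
open import Data.Fin as F using (Fin; toℕ; inject₁; fromℕ)
import Data.Fin.Properties as FP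
open import Data.Fin.Induction using (<-weakInduction)
open import Data.Fin.Permutation
  using (Permutation′; _⟨$⟩ʳ_; _⟨$⟩ˡ_; _∘ₚ_; flip; transpose; inverseˡ; inverseʳ; permutation)
import Data.Fin.Permutation.Components as PC
open import Data.Fin.Permutation.Transposition.List using (eval; decompose; eval-decompose)
open import Data.List using ([]; _∷_)
open import Data.Bool using (Bool; true; false; _∧_; not)
import Data.Bool as B
open import Data.Bool.Properties using (∨-zeroʳ; ∧-zeroʳ; ∧-identityʳ; ¬-not)
open import Data.Sum using (_⊎_; inj₁; inj₂; [_,_]′)
open import Data.Empty using (⊥-elim)
open import Function using (_∘_)
open import Function.Definitions using (Injective)
open import Relation.Nullary using (¬_; yes; no; does; _×-dec_)
open import Relation.Nullary.Decidable using (⌊_⌋; dec-true; dec-false)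
open import Relation.Binary.PropositionalEquality
  using (_≡_; _≢_; refl; trans; cong; cong₂; subst; subst₂) renaming (sym to ≡-sym)

transpose-matchˡ : ∀ {n} (i j : Fin n) → PC.transpose i j i ≡ j
transpose-matchˡ i j rewrite dec-true (i F.≟ i) refl = refl

transpose-matchʳ : ∀ {n} (i j : Fin n) → PC.transpose i j j ≡ i
transpose-matchʳ i j with j F.≟ i
... | yes j≡i = j≡i
... | no _ rewrite dec-true (j F.≟ j) refl = refl

transpose-other : ∀ {n} {i j k : Fin n} → k ≢ i → k ≢ j → PC.transpose i j k ≡ k
transpose-other {i = i} {j} {k} k≢i k≢j
  rewrite dec-false (k F.≟ i) k≢i | dec-false (k F.≟ j) k≢j = refl

data Position {n} (i j k : Fin n) : Set where
  atˡ   : k ≡ i → Position i j k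
  atʳ   : k ≢ i → k ≡ j → Position i j k
  apart : k ≢ i → k ≢ j → Position i j k

position : ∀ {n} (i j k : Fin n) → Position i j k
position i j k with k F.≟ i | k F.≟ j
... | yes k≡i | _       = atˡ k≡i
... | no k≢i  | yes k≡j = atʳ k≢i k≡j
... | no k≢i  | no k≢j  = apart k≢i k≢j

transpose-comm : ∀ {n} (i j k : Fin n) → PC.transpose i j k ≡ PC.transpose j i k
transpose-comm i j k with position i j k
... | atˡ refl    = trans (transpose-matchˡ k j) (≡-sym (transpose-matchʳ j k))
... | atʳ _ refl  = trans (transpose-matchʳ i k) (≡-sym (transpose-matchˡ k i))
... | apart k≢i k≢j = trans (transpose-other k≢i k≢j) (≡-sym (transpose-other k≢j k≢i))

transpose-same : ∀ {n} (i k : Fin n) → PC.transpose i i k ≡ k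
transpose-same i k with position i i k
... | atˡ refl      = transpose-matchˡ k k
... | atʳ k≢i k≡i   = ⊥-elim (k≢i k≡i)
... | apart k≢i _   = transpose-other k≢i k≢i

transpose-involutive : ∀ {n} (i j k : Fin n) → PC.transpose i j (PC.transpose i j k) ≡ k
transpose-involutive i j k =
  trans (cong (PC.transpose i j) (transpose-comm i j k)) (PC.transpose-inverse i j)

⟨$⟩ʳ-injective : ∀ {n} (π : Permutation′ n) {x y} → π ⟨$⟩ʳ x ≡ π ⟨$⟩ʳ y → x ≡ y
⟨$⟩ʳ-injective π {x} {y} e =
  trans (≡-sym (inverseˡ π)) (trans (cong (π ⟨$⟩ˡ_) e) (inverseˡ π))

transpose-natural : ∀ {n} (π : Permutation′ n) (a b y : Fin n) →
  π ⟨$⟩ʳ PC.transpose a b y ≡ PC.transpose (π ⟨$⟩ʳ a) (π ⟨$⟩ʳ b) (π ⟨$⟩ʳ y)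
transpose-natural π a b y with position a b y
... | atˡ refl =
  trans (cong (π ⟨$⟩ʳ_) (transpose-matchˡ y b)) (≡-sym (transpose-matchˡ (π ⟨$⟩ʳ y) (π ⟨$⟩ʳ b)))
... | atʳ _ refl =
  trans (cong (π ⟨$⟩ʳ_) (transpose-matchʳ a y)) (≡-sym (transpose-matchʳ (π ⟨$⟩ʳ a) (π ⟨$⟩ʳ y)))
... | apart y≢a y≢b =
  trans (cong (π ⟨$⟩ʳ_) (transpose-other y≢a y≢b))
        (≡-sym (transpose-other (λ e → y≢a (⟨$⟩ʳ-injective π e))
                                (λ e → y≢b (⟨$⟩ʳ-injective π e))))

transpose-conjugate : ∀ {n} (π : Permutation′ n) (a b z : Fin n) →
  (flip π ∘ₚ (transpose a b ∘ₚ π)) ⟨$⟩ʳ z ≡ transpose (π ⟨$⟩ʳ a) (π ⟨$⟩ʳ b) ⟨$⟩ʳ z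
transpose-conjugate π a b z =
  trans (transpose-natural π a b (π ⟨$⟩ˡ z))
        (cong (PC.transpose (π ⟨$⟩ʳ a) (π ⟨$⟩ʳ b)) (inverseʳ π))

module _ {n : ℕ} (X : Graph n) where

  InS-conjugate : ∀ {π} a b → InS X π → InS X (transpose a b) →
    InS X (transpose (π ⟨$⟩ʳ a) (π ⟨$⟩ʳ b))
  InS-conjugate {π} a b π∈ τ∈ = ext (comp (inv π∈) (comp τ∈ π∈)) (transpose-conjugate π a b)

  -- The transpositions through one fixed point w generate all transpositions:
  -- (i j) = (i w)(j w)(i w).
  InS-transpositions : (w : Fin n) → (∀ x → InS X (transpose x w)) →
    ∀ i j → InS X (transpose i j)
  InS-transpositions w star i j with i F.≟ w | j F.≟ w | i F.≟ j
  ... | _        | yes refl | _        = star i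
  ... | yes refl | no _     | _        = ext (star j) (transpose-comm j w)
  ... | no _     | no _     | yes refl = ext one (λ z → ≡-sym (transpose-same i z))
  ... | no i≢w   | no j≢w   | no i≢j   =
    ext (subst₂ (λ p q → InS X (transpose p q)) (transpose-other j≢i j≢w) (transpose-matchʳ i w)
                (InS-conjugate j w (star i) (star j)))
        (transpose-comm j i)
    where
      j≢i : j ≢ i
      j≢i e = i≢j (≡-sym e)

  -- Since every permutation is a product of transpositions, it suffices that
  -- S_X contains all transpositions through a single point.
  localAmoeba-fromStar : (w : Fin n) → (∀ x → InS X (transpose x w)) → LocalAmoeba X
  localAmoeba-fromStar w star π = ext (product (decompose π)) (eval-decompose π)
    where
      product : ∀ xs → InS X (eval xs)
      product []             = one
      product ((i , j) ∷ xs) = comp (InS-transpositions w star i j) (product xs)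

false≢true : false ≢ true
false≢true ()

Same : ∀ {A : Set} → A → A → A → A → Set
Same a b r s = (a ≡ r × b ≡ s) ⊎ (a ≡ s × b ≡ r)

samePair-sound : ∀ {n} (a b r s : Fin n) → samePair a b r s ≡ true → Same a b r s
samePair-sound a b r s e with a F.≟ r | b F.≟ s | a F.≟ s | b F.≟ r
... | yes a≡r | yes b≡s | _       | _       = inj₁ (a≡r , b≡s)
... | _       | _       | yes a≡s | yes b≡r = inj₂ (a≡s , b≡r)
samePair-sound a b r s () | no _ | _ | no _ | _
samePair-sound a b r s () | no _ | _ | yes _ | no _
samePair-sound a b r s () | yes _ | no _ | no _ | _
samePair-sound a b r s () | yes _ | no _ | yes _ | no _

⌊≟⌋-refl : ∀ {n} (x : Fin n) → ⌊ x F.≟ x ⌋ ≡ true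
⌊≟⌋-refl x with x F.≟ x
... | yes _   = refl
... | no x≢x = ⊥-elim (x≢x refl)

samePair-complete : ∀ {n} {a b r s : Fin n} → Same a b r s → samePair a b r s ≡ true
samePair-complete {a = a} {b} (inj₁ (refl , refl)) rewrite ⌊≟⌋-refl a | ⌊≟⌋-refl b = refl
samePair-complete {a = a} {b} (inj₂ (refl , refl)) rewrite ⌊≟⌋-refl a | ⌊≟⌋-refl b = ∨-zeroʳ _

Same-map : ∀ {A B : Set} (f : A → B) {a b r s} → Same a b r s → Same (f a) (f b) (f r) (f s)
Same-map f (inj₁ (refl , refl)) = inj₁ (refl , refl)
Same-map f (inj₂ (refl , refl)) = inj₂ (refl , refl)

module _ {n : ℕ} (X : Graph n) where

  adj-Same : ∀ {a b r s} → Same a b r s → adj X a b ≡ adj X r s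
  adj-Same (inj₁ (refl , refl)) = refl
  adj-Same {a} {b} (inj₂ (refl , refl)) = Graph.sym X a b

  replace-self : ∀ {r s} → adj X r s ≡ true → replace X r s r s ≐ adj X
  replace-self {r} {s} rs∈ a b with samePair a b r s in same
  ... | true  = ≡-sym (trans (adj-Same (samePair-sound a b r s same)) rs∈)
  ... | false = refl

  -- As soon as X has an edge, every automorphism of X is a generator of S_X
  -- (it realises the trivial replacement of that edge by itself).
  automorphism-InS : ∀ {σ r s} → adj X r s ≡ true → permuted X σ ≐ adj X → InS X σ
  automorphism-InS {σ} {r} {s} rs∈ auto =
    gen (r , s , r , s , ((rs∈ , inj₂ rs≡rs) , (σ , realises)) , realises)
    where
      rs≡rs : samePair r s r s ≡ true
      rs≡rs = samePair-complete {a = r} {s} (inj₁ (refl , refl))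

      realises : permuted X σ ≐ replace X r s r s
      realises a b = trans (auto a b) (≡-sym (replace-self rs∈ a b))

  replacement-InS : ∀ {σ r s k l} → adj X r s ≡ true → adj X k l ≡ false → k ≢ l →
    permuted X σ k l ≡ true → permuted X σ r s ≡ false →
    (∀ a b → ¬ Same a b k l → ¬ Same a b r s → permuted X σ a b ≡ adj X a b) →
    InS X σ
  replacement-InS {σ} {r} {s} {k} {l} rs∈ kl∉ k≢l kl↦ rs↦ rest =
    gen (r , s , k , l , ((rs∈ , inj₁ (kl∉ , k≢l)) , (σ , realises)) , realises)
    where
      permuted-Same : ∀ {a b c d} → Same a b c d → permuted X σ a b ≡ permuted X σ c d
      permuted-Same same = adj-Same (Same-map (σ ⟨$⟩ʳ_) same)

      realises : permuted X σ ≐ replace X r s k l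
      realises a b with samePair a b k l in same-kl
      ... | true = trans (permuted-Same (samePair-sound a b k l same-kl)) kl↦
      ... | false with samePair a b r s in same-rs
      ...   | true  = trans (permuted-Same (samePair-sound a b r s same-rs)) rs↦
      ...   | false = rest a b (λ same → false≢true (trans (≡-sym same-kl) (samePair-complete same)))
                               (λ same → false≢true (trans (≡-sym same-rs) (samePair-complete same)))

  Isolated : Fin n → Set
  Isolated x = ∀ u → adj X x u ≡ false

  isolated-right : ∀ {x} → Isolated x → ∀ u → adj X u x ≡ false
  isolated-right {x} x-iso u = trans (Graph.sym X u x) (x-iso u)

  isolated-swap : ∀ {x w} → Isolated x → Isolated w → permuted X (transpose x w) ≐ adj X
  isolated-swap {x} {w} x-iso w-iso a b with position x w a
  ... | atˡ refl = trans (cong (λ u → adj X u (PC.transpose x w b)) (transpose-matchˡ x w))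
                         (trans (w-iso (PC.transpose x w b)) (≡-sym (x-iso b)))
  ... | atʳ _ refl = trans (cong (λ u → adj X u (PC.transpose x w b)) (transpose-matchʳ x w))
                           (trans (x-iso (PC.transpose x w b)) (≡-sym (w-iso b)))
  ... | apart a≢x a≢w with position x w b
  ...   | atˡ refl = trans (cong₂ (adj X) (transpose-other a≢x a≢w) (transpose-matchˡ x w))
                           (trans (isolated-right w-iso a) (≡-sym (isolated-right x-iso a)))
  ...   | atʳ _ refl = trans (cong₂ (adj X) (transpose-other a≢x a≢w) (transpose-matchʳ x w))
                             (trans (isolated-right x-iso a) (≡-sym (isolated-right w-iso a)))
  ...   | apart b≢x b≢w = cong₂ (adj X) (transpose-other a≢x a≢w) (transpose-other b≢x b≢w)

  isolated-transpose-InS : ∀ {r s x w} → adj X r s ≡ true → Isolated x → Isolated w →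
    InS X (transpose x w)
  isolated-transpose-InS rs∈ x-iso w-iso = automorphism-InS rs∈ (isolated-swap x-iso w-iso)

-- A graph X on Fin n presented on another vertex type V through a bijection
-- enc/dec, with adjacency A on V.  The generator criteria above transfer to
-- permutations of V.
module Presentation {n : ℕ} (X : Graph n) {V : Set}
  (enc : V → Fin n) (dec : Fin n → V)
  (dec-enc : ∀ u → dec (enc u) ≡ u) (enc-dec : ∀ x → enc (dec x) ≡ x)
  (A : V → V → Bool) (adj-dec : ∀ x y → adj X x y ≡ A (dec x) (dec y)) where

  adj-enc : ∀ u v → adj X (enc u) (enc v) ≡ A u v
  adj-enc u v = trans (adj-dec (enc u) (enc v)) (cong₂ A (dec-enc u) (dec-enc v))

  isolatedV : ∀ {u} → (∀ v → A u v ≡ false) → Isolated X (enc u)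
  isolatedV {u} u-iso y = trans (adj-dec (enc u) y) (trans (cong (λ z → A z (dec y)) (dec-enc u)) (u-iso (dec y)))

  module _ (f : V → V) (f-involutive : ∀ u → f (f u) ≡ u) where

    relabel : Permutation′ n
    relabel = permutation g g g-involutive g-involutive
      where
        g : Fin n → Fin n
        g x = enc (f (dec x))
        g-involutive : ∀ x → g (g x) ≡ x
        g-involutive x =
          trans (cong (λ u → enc (f u)) (dec-enc (f (dec x))))
                (trans (cong enc (f-involutive (dec x))) (enc-dec x))

    relabel-enc : ∀ u → relabel ⟨$⟩ʳ enc u ≡ enc (f u)
    relabel-enc u = cong (λ v → enc (f v)) (dec-enc u)

    permuted-relabel : ∀ a b → permuted X relabel a b ≡ A (f (dec a)) (f (dec b))
    permuted-relabel a b = adj-enc (f (dec a)) (f (dec b))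

    permuted-enc : ∀ u v → permuted X relabel (enc u) (enc v) ≡ A (f u) (f v)
    permuted-enc u v = trans (permuted-relabel (enc u) (enc v)) (cong₂ (λ x y → A (f x) (f y)) (dec-enc u) (dec-enc v))

    automorphismV : ∀ {r s} → A r s ≡ true → (∀ u v → A (f u) (f v) ≡ A u v) → InS X relabel
    automorphismV {r} {s} rs∈ auto =
      automorphism-InS X (trans (adj-enc r s) rs∈)
        (λ a b → trans (permuted-relabel a b) (trans (auto (dec a) (dec b)) (≡-sym (adj-dec a b))))

    replacementV : ∀ {r s k l} → A r s ≡ true → A k l ≡ false → k ≢ l →
      A (f k) (f l) ≡ true → A (f r) (f s) ≡ false →
      (∀ u v → ¬ Same u v k l → ¬ Same u v r s → A (f u) (f v) ≡ A u v) →
      InS X relabel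
    replacementV {r} {s} {k} {l} rs∈ kl∉ k≢l kl↦ rs↦ rest =
      replacement-InS X (trans (adj-enc r s) rs∈) (trans (adj-enc k l) kl∉)
        (λ e → k≢l (trans (≡-sym (dec-enc k)) (trans (cong dec e) (dec-enc l))))
        (trans (permuted-enc k l) kl↦) (trans (permuted-enc r s) rs↦)
        (λ a b ¬kl ¬rs → trans (permuted-relabel a b)
                           (trans (rest (dec a) (dec b) (encoded ¬kl) (encoded ¬rs)) (≡-sym (adj-dec a b))))
      where
        encoded : ∀ {a b c d} → ¬ Same a b (enc c) (enc d) → ¬ Same (dec a) (dec b) c d
        encoded {a} {b} ¬same same =
          ¬same (subst₂ (λ x y → Same x y _ _) (enc-dec a) (enc-dec b) (Same-map enc same))

-- f embeds G into H as a union of connected components of H: f is injective,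
-- preserves and reflects adjacency, and the neighbours of image vertices are
-- image vertices.
record ComponentEmbedding {n m} (G : Graph n) (H : Graph m) (f : Fin n → Fin m) : Set where
  field
    injective        : Injective _≡_ _≡_ f
    adj-preserved    : ∀ a b → adj H (f a) (f b) ≡ adj G a b
    neighbour-closed : ∀ a y → adj H (f a) y ≡ true → ∃[ b ] f b ≡ y

componentEmbedding-∘ : ∀ {n m o} {G : Graph n} {H : Graph m} {K : Graph o} {f g} →
  ComponentEmbedding G H f → ComponentEmbedding H K g → ComponentEmbedding G K (g ∘ f)
componentEmbedding-∘ {H = H} {K = K} {f} {g} f-emb g-emb = record
  { injective        = λ e → Ef.injective (Eg.injective e)
  ; adj-preserved    = λ a b → trans (Eg.adj-preserved (f a) (f b)) (Ef.adj-preserved a b)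
  ; neighbour-closed = λ a y edge →
      let (c , gc≡y) = Eg.neighbour-closed (f a) y edge
          (b , fb≡c) = Ef.neighbour-closed a c
                         (trans (≡-sym (Eg.adj-preserved (f a) c)) (trans (cong (adj K (g (f a))) gc≡y) edge))
      in b , trans (cong g fb≡c) gc≡y
  }
  where
    module Ef = ComponentEmbedding f-emb
    module Eg = ComponentEmbedding g-emb

component : ∀ {n m} {G : Graph (suc n)} {H : Graph m} {f} →
  Connected G → ComponentEmbedding G H f → HasComponentIso H G
component {G = G} {H} {f} connected emb =
  f F.zero , f , injective , adj-preserved ,
  (λ y reach → stays-in-image reach F.zero refl) , (λ a → image-walk (connected F.zero a))
  where
    open ComponentEmbedding emb

    stays-in-image : ∀ {y z} → Reach H y z → ∀ a → f a ≡ y → ∃[ b ] f b ≡ z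
    stays-in-image here a fa≡y = a , fa≡y
    stays-in-image (step {y = y′} edge reach) a refl =
      let (b , fb≡y′) = neighbour-closed a y′ edge in stays-in-image reach b fb≡y′

    image-walk : ∀ {u v} → Reach G u v → Reach H (f u) (f v)
    image-walk here = here
    image-walk (step {x = u} {y = w} edge reach) = step (trans (adj-preserved u w) edge) (image-walk reach)

module _ {n m : ℕ} (G : Graph n) (K : Graph m) where

  sumAdj : Fin n ⊎ Fin m → Fin n ⊎ Fin m → Bool
  sumAdj (inj₁ a) (inj₁ b) = adj G a b
  sumAdj (inj₁ _) (inj₂ _) = false
  sumAdj (inj₂ _) (inj₁ _) = false
  sumAdj (inj₂ x) (inj₂ y) = adj K x y

  sumAdj-sym : ∀ u v → sumAdj u v ≡ sumAdj v u
  sumAdj-sym (inj₁ a) (inj₁ b) = Graph.sym G a b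
  sumAdj-sym (inj₁ _) (inj₂ _) = refl
  sumAdj-sym (inj₂ _) (inj₁ _) = refl
  sumAdj-sym (inj₂ x) (inj₂ y) = Graph.sym K x y

  sumAdj-irrefl : ∀ u → sumAdj u u ≡ false
  sumAdj-irrefl (inj₁ a) = Graph.irrefl G a
  sumAdj-irrefl (inj₂ x) = Graph.irrefl K x

  _⊕_ : Graph (n + m)
  _⊕_ = record
    { adj    = λ a b → sumAdj (F.splitAt n a) (F.splitAt n b)
    ; sym    = λ a b → sumAdj-sym (F.splitAt n a) (F.splitAt n b)
    ; irrefl = λ a → sumAdj-irrefl (F.splitAt n a)
    }

  ⊕-right : ∀ x y → adj _⊕_ (n F.↑ʳ x) (n F.↑ʳ y) ≡ adj K x y
  ⊕-right x y = cong₂ sumAdj (FP.splitAt-↑ʳ n m x) (FP.splitAt-↑ʳ n m y)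

  ⊕-left : ComponentEmbedding G _⊕_ (F._↑ˡ m)
  ⊕-left = record
    { injective        = λ {a} {b} → FP.↑ˡ-injective m a b
    ; adj-preserved    = λ a b → cong₂ sumAdj (FP.splitAt-↑ˡ n a m) (FP.splitAt-↑ˡ n b m)
    ; neighbour-closed = λ a y edge → on-the-left y (F.splitAt n y) refl
        (trans (≡-sym (cong (λ u → sumAdj u (F.splitAt n y)) (FP.splitAt-↑ˡ n a m))) edge)
    }
    where
      on-the-left : ∀ {a} y u → F.splitAt n y ≡ u → sumAdj (inj₁ a) u ≡ true → ∃[ b ] b F.↑ˡ m ≡ y
      on-the-left y (inj₁ b) split≡ _ = b , trans (cong (F.join n m) (≡-sym split≡)) (FP.join-splitAt n m y)

K₂ : Graph 2
K₂ = record { adj = λ x y → not (does (x F.≟ y)) ; sym = K₂-sym ; irrefl = K₂-irrefl }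
  where
    K₂-sym : ∀ x y → not (does (x F.≟ y)) ≡ not (does (y F.≟ x))
    K₂-sym x y with x F.≟ y
    ... | yes refl = cong not (≡-sym (dec-true (x F.≟ x) refl))
    ... | no x≢y   = cong not (≡-sym (dec-false (y F.≟ x) (λ e → x≢y (≡-sym e))))

    K₂-irrefl : ∀ x → not (does (x F.≟ x)) ≡ false
    K₂-irrefl x = cong not (dec-true (x F.≟ x) refl)

module PairCode {N : ℕ} where

  pairCode : Fin N → Fin N → Fin (N * N)
  pairCode a b with a FP.≤? b
  ... | yes _ = F.combine a b
  ... | no _  = F.combine b a

  pairCode-sym : ∀ a b → pairCode a b ≡ pairCode b a
  pairCode-sym a b with a FP.≤? b | b FP.≤? a
  ... | yes a≤b | yes b≤a = cong₂ F.combine (FP.≤-antisym a≤b b≤a) (FP.≤-antisym b≤a a≤b)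
  ... | yes _   | no _    = refl
  ... | no _    | yes _   = refl
  ... | no a≰b  | no b≰a  = ⊥-elim ([ a≰b , b≰a ]′ (FP.≤-total a b))

  pairCode-Same : ∀ {a b c d} → Same a b c d → pairCode a b ≡ pairCode c d
  pairCode-Same (inj₁ (refl , refl)) = refl
  pairCode-Same {a} {b} (inj₂ (refl , refl)) = pairCode-sym a b

  decodeˡ decodeʳ : Fin (N * N) → Fin N
  decodeˡ i = proj₁ (F.remQuot {N} N i)
  decodeʳ i = proj₂ (F.remQuot {N} N i)

  pairCode-decode : ∀ {a b i} → pairCode a b ≡ i → Same a b (decodeˡ i) (decodeʳ i)
  pairCode-decode {a} {b} refl with a FP.≤? b
  ... | yes _ = inj₁ (≡-sym (cong proj₁ (FP.remQuot-combine a b)) ,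
                     ≡-sym (cong proj₂ (FP.remQuot-combine a b)))
  ... | no _  = inj₂ (≡-sym (cong proj₂ (FP.remQuot-combine b a)) ,
                     ≡-sym (cong proj₁ (FP.remQuot-combine b a)))

<?-suc : ∀ {m n} → m ≢ n → does (m <? suc n) ≡ does (m <? n)
<?-suc {m} {n} m≢n with m <? n
... | yes m<n = trans (dec-true (m <? suc n) (NP.m<n⇒m<1+n m<n)) (≡-sym (dec-true (m <? n) m<n))
... | no m≮n  = trans (dec-false (m <? suc n) (λ m<1+n → m≮n (NP.≤∧≢⇒< (NP.≤-pred m<1+n) m≢n)))
                      (≡-sym (dec-false (m <? n) m≮n))

module Telescope {N : ℕ} (Q : Graph N) where
  open PairCode {N}

  P : ℕ
  P = N * N

  Layer : Set
  Layer = Fin (suc P)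

  inLayer : Layer → Fin P → Bool
  inLayer k c = does (toℕ c <? toℕ k)

  inLayer-step : ∀ {i c} → c ≢ i → inLayer (F.suc i) c ≡ inLayer (inject₁ i) c
  inLayer-step {i} {c} c≢i rewrite FP.toℕ-inject₁ i = <?-suc (λ e → c≢i (FP.toℕ-injective e))

  inLayer-new : ∀ i → inLayer (F.suc i) i ≡ true
  inLayer-new i = dec-true (toℕ i <? suc (toℕ i)) (NP.n<1+n (toℕ i))

  inLayer-old : ∀ i → inLayer (inject₁ i) i ≡ false
  inLayer-old i rewrite FP.toℕ-inject₁ i = dec-false (toℕ i <? toℕ i) (NP.<-irrefl refl)

  inLayer-last : ∀ c → inLayer (fromℕ P) c ≡ true
  inLayer-last c rewrite FP.toℕ-fromℕ P = dec-true (toℕ c <? P) (FP.toℕ<n c)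

  layerAdj : Layer → Fin N → Fin N → Bool
  layerAdj k a b = inLayer k (pairCode a b) ∧ adj Q a b

  layerAdj-sym : ∀ k a b → layerAdj k a b ≡ layerAdj k b a
  layerAdj-sym k a b = cong₂ (λ c e → inLayer k c ∧ e) (pairCode-sym a b) (Graph.sym Q a b)

  layerAdj-last : ∀ a b → layerAdj (fromℕ P) a b ≡ adj Q a b
  layerAdj-last a b = cong (_∧ adj Q a b) (inLayer-last (pairCode a b))

  layerAdj-step : ∀ {i a b} → (pairCode a b ≡ i → adj Q a b ≡ false) →
    layerAdj (F.suc i) a b ≡ layerAdj (inject₁ i) a b
  layerAdj-step {i} {a} {b} code-i⇒∉ with pairCode a b F.≟ i
  ... | yes code≡i rewrite code-i⇒∉ code≡i = trans (∧-zeroʳ _) (≡-sym (∧-zeroʳ _))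
  ... | no code≢i = cong (_∧ adj Q a b) (inLayer-step code≢i)

  layerAdj-new : ∀ {i a b} → pairCode a b ≡ i → adj Q a b ≡ true → layerAdj (F.suc i) a b ≡ true
  layerAdj-new {a = a} {b} refl ab∈ =
    trans (cong (inLayer (F.suc (pairCode a b)) (pairCode a b) ∧_) ab∈)
          (trans (∧-identityʳ _) (inLayer-new (pairCode a b)))

  layerAdj-old : ∀ {i a b} → pairCode a b ≡ i → layerAdj (inject₁ i) a b ≡ false
  layerAdj-old {i} {a} {b} refl rewrite inLayer-old i = refl

  layered : Layer → Fin N → Layer → Fin N → Bool
  layered k a k′ b = does (k F.≟ k′) ∧ layerAdj k a b

  layered-diag : ∀ k a b → layered k a k b ≡ layerAdj k a b
  layered-diag k a b rewrite dec-true (k F.≟ k) refl = refl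

  layered-sym : ∀ k a k′ b → layered k a k′ b ≡ layered k′ b k a
  layered-sym k a k′ b with k F.≟ k′
  ... | yes refl = trans (layerAdj-sym k a b) (≡-sym (layered-diag k b a))
  ... | no k≢k′ rewrite dec-false (k′ F.≟ k) (λ e → k≢k′ (≡-sym e)) = refl

  layered-irrefl : ∀ k a → layered k a k a ≡ false
  layered-irrefl k a =
    trans (layered-diag k a a) (trans (cong (inLayer k (pairCode a a) ∧_) (Graph.irrefl Q a)) (∧-zeroʳ _))

  -- The telescope as a graph on Fin ((P + 1) · N); vertex combine k a is copy a in layer k.
  cell : Fin (suc P * N) → Layer × Fin N
  cell = F.remQuot {suc P} N

  H : Graph (suc P * N)
  H = record
    { adj    = λ x y → layered (proj₁ (cell x)) (proj₂ (cell x)) (proj₁ (cell y)) (proj₂ (cell y))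
    ; sym    = λ x y → layered-sym (proj₁ (cell x)) (proj₂ (cell x)) (proj₁ (cell y)) (proj₂ (cell y))
    ; irrefl = λ x → layered-irrefl (proj₁ (cell x)) (proj₂ (cell x))
    }

  swapLayers : Fin P → Layer → Layer
  swapLayers i = PC.transpose (inject₁ i) (F.suc i)

  swapLayers-involutive : ∀ i k → swapLayers i (swapLayers i k) ≡ k
  swapLayers-involutive i = transpose-involutive (inject₁ i) (F.suc i)

  layered-swap : ∀ i k a k′ b →
    (k ≡ k′ → k ≡ inject₁ i ⊎ k ≡ F.suc i → pairCode a b ≡ i → adj Q a b ≡ false) →
    layered (swapLayers i k) a (swapLayers i k′) b ≡ layered k a k′ b
  layered-swap i k a k′ b code-i⇒∉ with k F.≟ k′
  ... | no k≢k′ =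
    cong (_∧ layerAdj (swapLayers i k) a b) (dec-false (swapLayers i k F.≟ swapLayers i k′) swapped≢)
    where
      swapped≢ : swapLayers i k ≢ swapLayers i k′
      swapped≢ e = k≢k′ (trans (≡-sym (swapLayers-involutive i k))
                          (trans (cong (swapLayers i) e) (swapLayers-involutive i k′)))
  ... | yes refl = trans (layered-diag (swapLayers i k) a b) (swapped (position (inject₁ i) (F.suc i) k))
    where
      swapped : Position (inject₁ i) (F.suc i) k → layerAdj (swapLayers i k) a b ≡ layerAdj k a b
      swapped (atˡ refl) = trans (cong (λ l → layerAdj l a b) (transpose-matchˡ k (F.suc i)))
                                 (layerAdj-step (code-i⇒∉ refl (inj₁ refl)))
      swapped (atʳ _ refl) = trans (cong (λ l → layerAdj l a b) (transpose-matchʳ (inject₁ i) k))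
                                   (≡-sym (layerAdj-step (code-i⇒∉ refl (inj₂ refl))))
      swapped (apart k≢i k≢1+i) = cong (λ l → layerAdj l a b) (transpose-other k≢i k≢1+i)

  no-edge-of-code : ∀ {i} →
    ¬ (pairCode (decodeˡ i) (decodeʳ i) ≡ i × adj Q (decodeˡ i) (decodeʳ i) ≡ true) →
    ∀ {a b} → pairCode a b ≡ i → adj Q a b ≡ false
  no-edge-of-code ¬edge {a} {b} code = ¬-not λ ab∈ →
    ¬edge (trans (≡-sym (pairCode-Same same)) code , trans (≡-sym (adj-Same Q same)) ab∈)
    where
      same = pairCode-decode code

  data Vertex (t : ℕ) : Set where
    copy : Layer → Fin N → Vertex t
    pad  : Fin t → Vertex t

  module Padded {r₀ s₀ : Fin N} (r₀s₀∈ : adj Q r₀ s₀ ≡ true) (t : ℕ) where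

    m : ℕ
    m = suc P * N

    -- X = H ∪ (t + 1)K₁, presented on Vertex (suc t) by enc/dec and adjacency A.
    X : Graph (m + suc t)
    X = addIsolated H (suc t)

    enc : Vertex (suc t) → Fin (m + suc t)
    enc (copy k a) = F.combine k a F.↑ˡ suc t
    enc (pad j)    = m F.↑ʳ j

    fromSplit : Fin m ⊎ Fin (suc t) → Vertex (suc t)
    fromSplit (inj₁ y) = copy (proj₁ (cell y)) (proj₂ (cell y))
    fromSplit (inj₂ j) = pad j

    dec : Fin (m + suc t) → Vertex (suc t)
    dec x = fromSplit (F.splitAt m x)

    dec-enc : ∀ u → dec (enc u) ≡ u
    dec-enc (copy k a) = trans (cong fromSplit (FP.splitAt-↑ˡ m (F.combine k a) (suc t)))
                               (cong (λ p → copy (proj₁ p) (proj₂ p)) (FP.remQuot-combine {suc P} {N} k a))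
    dec-enc (pad j)    = cong fromSplit (FP.splitAt-↑ʳ m (suc t) j)

    enc-dec : ∀ x → enc (dec x) ≡ x
    enc-dec x = trans (enc-fromSplit (F.splitAt m x)) (FP.join-splitAt m (suc t) x)
      where
        enc-fromSplit : ∀ s → enc (fromSplit s) ≡ F.join m (suc t) s
        enc-fromSplit (inj₁ y) = cong (F._↑ˡ suc t) (FP.combine-remQuot {suc P} N y)
        enc-fromSplit (inj₂ j) = refl

    A : Vertex (suc t) → Vertex (suc t) → Bool
    A (copy k a) (copy k′ b) = layered k a k′ b
    A (copy _ _) (pad _)     = false
    A (pad _)    _           = false

    adj-dec : ∀ x y → adj X x y ≡ A (dec x) (dec y)
    adj-dec x y with F.splitAt m x | F.splitAt m y
    ... | inj₁ _ | inj₁ _ = refl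
    ... | inj₁ _ | inj₂ _ = refl
    ... | inj₂ _ | inj₁ _ = refl
    ... | inj₂ _ | inj₂ _ = refl

    open Presentation X enc dec dec-enc enc-dec A adj-dec

    copy-injectiveʳ : ∀ {k a k′ b} → copy {suc t} k a ≡ copy k′ b → a ≡ b
    copy-injectiveʳ refl = refl

    swapV : Fin P → Vertex (suc t) → Vertex (suc t)
    swapV i (copy k a) = copy (swapLayers i k) a
    swapV i (pad j)    = pad j

    swapV-involutive : ∀ i u → swapV i (swapV i u) ≡ u
    swapV-involutive i (copy k a) = cong (λ l → copy l a) (swapLayers-involutive i k)
    swapV-involutive i (pad j)    = refl

    data CodeEdge (i : Fin P) : Vertex (suc t) → Vertex (suc t) → Set where
      codeEdge : ∀ {k a b} → k ≡ inject₁ i ⊎ k ≡ F.suc i → pairCode a b ≡ i → adj Q a b ≡ true →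
        CodeEdge i (copy k a) (copy k b)

    A-swap : ∀ i u v → ¬ CodeEdge i u v → A (swapV i u) (swapV i v) ≡ A u v
    A-swap i (copy k a) (copy k′ b) ¬edge =
      layered-swap i k a k′ b (λ { refl side code → ¬-not (λ ab∈ → ¬edge (codeEdge side code ab∈)) })
    A-swap i (copy _ _) (pad _) _ = refl
    A-swap i (pad _)    _       _ = refl

    σ : Fin P → Permutation′ (m + suc t)
    σ i = relabel (swapV i) (swapV-involutive i)

    -- The edge r₀s₀ in the last layer, used for the trivial replacements.
    lastEdge : A (copy (fromℕ P) r₀) (copy (fromℕ P) s₀) ≡ true
    lastEdge = trans (layered-diag (fromℕ P) r₀ s₀) (trans (layerAdj-last r₀ s₀) r₀s₀∈)

    swap-automorphism : ∀ i → (∀ {a b} → pairCode a b ≡ i → adj Q a b ≡ false) → InS X (σ i)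
    swap-automorphism i code-i⇒∉ =
      automorphismV (swapV i) (swapV-involutive i) {copy (fromℕ P) r₀} {copy (fromℕ P) s₀} lastEdge
        (λ u v → A-swap i u v
           λ { (codeEdge _ code ab∈) → false≢true (trans (≡-sym (code-i⇒∉ code)) ab∈) })

    -- The edge a₀b₀ of code i: exchanging layers i and i + 1 realises the
    -- feasible replacement of a₀b₀ in layer i + 1 by a₀b₀ in layer i.
    swap-replacement : ∀ i → let a₀ = decodeˡ i; b₀ = decodeʳ i in
      pairCode a₀ b₀ ≡ i → adj Q a₀ b₀ ≡ true → InS X (σ i)
    swap-replacement i code a₀b₀∈ =
      replacementV (swapV i) (swapV-involutive i) rs∈ kl∉ (λ k≡l → a₀≢b₀ (copy-injectiveʳ k≡l))
        (trans (cong₂ A k↦r l↦s) rs∈) (trans (cong₂ A r↦k s↦l) kl∉)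
        (λ u v ¬kl ¬rs → A-swap i u v (only-edge ¬kl ¬rs))
      where
        a₀ = decodeˡ i
        b₀ = decodeʳ i
        r s k l : Vertex (suc t)
        r = copy (F.suc i) a₀
        s = copy (F.suc i) b₀
        k = copy (inject₁ i) a₀
        l = copy (inject₁ i) b₀

        rs∈ : A r s ≡ true
        rs∈ = trans (layered-diag (F.suc i) a₀ b₀) (layerAdj-new code a₀b₀∈)

        kl∉ : A k l ≡ false
        kl∉ = trans (layered-diag (inject₁ i) a₀ b₀) (layerAdj-old code)

        k↦r : swapV i k ≡ r
        k↦r = cong (λ k′ → copy k′ a₀) (transpose-matchˡ (inject₁ i) (F.suc i))
        l↦s : swapV i l ≡ s
        l↦s = cong (λ k′ → copy k′ b₀) (transpose-matchˡ (inject₁ i) (F.suc i))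
        r↦k : swapV i r ≡ k
        r↦k = cong (λ k′ → copy k′ a₀) (transpose-matchʳ (inject₁ i) (F.suc i))
        s↦l : swapV i s ≡ l
        s↦l = cong (λ k′ → copy k′ b₀) (transpose-matchʳ (inject₁ i) (F.suc i))

        a₀≢b₀ : a₀ ≢ b₀
        a₀≢b₀ a₀≡b₀ =
          false≢true (trans (≡-sym (Graph.irrefl Q a₀)) (trans (cong (adj Q a₀) a₀≡b₀) a₀b₀∈))

        only-edge : ∀ {u v} → ¬ Same u v k l → ¬ Same u v r s → ¬ CodeEdge i u v
        only-edge ¬kl ¬rs (codeEdge {k′} (inj₁ refl) code′ _) = ¬kl (Same-map (copy k′) (pairCode-decode code′))
        only-edge ¬kl ¬rs (codeEdge {k′} (inj₂ refl) code′ _) = ¬rs (Same-map (copy k′) (pairCode-decode code′))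

    swap-InS : ∀ i → InS X (σ i)
    swap-InS i with pairCode (decodeˡ i) (decodeʳ i) F.≟ i ×-dec adj Q (decodeˡ i) (decodeʳ i) B.≟ true
    ... | yes (code , a₀b₀∈) = swap-replacement i code a₀b₀∈
    ... | no ¬edge           = swap-automorphism i (no-edge-of-code ¬edge)

    anchor : Vertex (suc t)
    anchor = pad F.zero

    Star : Vertex (suc t) → Set
    Star u = InS X (transpose (enc u) (enc anchor))

    isolated-star : ∀ u → (∀ v → A u v ≡ false) → Star u
    isolated-star u u-iso =
      isolated-transpose-InS X (trans (adj-enc (copy (fromℕ P) r₀) (copy (fromℕ P) s₀)) lastEdge)
        (isolatedV {u} u-iso) (isolatedV {anchor} (λ _ → refl))

    layer-zero-isolated : ∀ a v → A (copy F.zero a) v ≡ false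
    layer-zero-isolated a (copy k b) = ∧-zeroʳ (does (F.zero F.≟ k))
    layer-zero-isolated a (pad _)    = refl

    -- Layer 0 is edgeless, and conjugation by σ i carries the transposition
    -- (copy a in layer i, anchor) to (copy a in layer i + 1, anchor).
    layer-star : ∀ k a → Star (copy k a)
    layer-star = <-weakInduction (λ k → ∀ a → Star (copy k a))
                   (λ a → isolated-star (copy F.zero a) (layer-zero-isolated a)) next-layer
      where
        next-layer : ∀ i → (∀ a → Star (copy (inject₁ i) a)) → ∀ a → Star (copy (F.suc i) a)
        next-layer i star-i a =
          subst₂ (λ x y → InS X (transpose x y)) moved (relabel-enc (swapV i) (swapV-involutive i) anchor)
            (InS-conjugate X {σ i} (enc (copy (inject₁ i) a)) (enc anchor) (swap-InS i) (star-i a))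
          where
            moved : σ i ⟨$⟩ʳ enc (copy (inject₁ i) a) ≡ enc (copy (F.suc i) a)
            moved = trans (relabel-enc (swapV i) (swapV-involutive i) (copy (inject₁ i) a))
                          (cong (λ k → enc (copy k a)) (transpose-matchˡ (inject₁ i) (F.suc i)))

    star : ∀ u → Star u
    star (copy k a) = layer-star k a
    star (pad j)    = isolated-star (pad j) (λ _ → refl)

    localAmoeba : LocalAmoeba X
    localAmoeba = localAmoeba-fromStar X (enc anchor)
      (λ x → subst (λ y → InS X (transpose y (enc anchor))) (enc-dec x) (star (dec x)))

  telescope-globalAmoeba : ∀ r₀ s₀ → adj Q r₀ s₀ ≡ true → GlobalAmoeba H
  telescope-globalAmoeba r₀ s₀ r₀s₀∈ = 1 , λ { zero () ; (suc t) _ → Padded.localAmoeba r₀s₀∈ t }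

  lastLayer : Fin N → Fin (suc P * N)
  lastLayer = F.combine (fromℕ P)

  layered-sameLayer : ∀ k a k′ b → layered k a k′ b ≡ true → k ≡ k′
  layered-sameLayer k a k′ b edge with k F.≟ k′
  ... | yes k≡k′ = k≡k′

  adj-lastLayer : ∀ a y → adj H (lastLayer a) y ≡ layered (fromℕ P) a (proj₁ (cell y)) (proj₂ (cell y))
  adj-lastLayer a y =
    cong (λ p → layered (proj₁ p) (proj₂ p) (proj₁ (cell y)) (proj₂ (cell y))) (FP.remQuot-combine (fromℕ P) a)

  lastLayer-embedding : ComponentEmbedding Q H lastLayer
  lastLayer-embedding = record
    { injective        = λ {a} {b} e → FP.combine-injectiveʳ (fromℕ P) a (fromℕ P) b e
    ; adj-preserved    = λ a b → trans (adj-lastLayer a (lastLayer b))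
        (trans (cong (λ p → layered (fromℕ P) a (proj₁ p) (proj₂ p)) (FP.remQuot-combine (fromℕ P) b))
               (trans (layered-diag (fromℕ P) a b) (layerAdj-last a b)))
    ; neighbour-closed = λ a y edge →
        proj₂ (cell y) ,
        trans (cong (λ k → F.combine k (proj₂ (cell y)))
                (layered-sameLayer (fromℕ P) a (proj₁ (cell y)) (proj₂ (cell y))
                                   (trans (≡-sym (adj-lastLayer a y)) edge)))
              (FP.combine-remQuot {suc P} N y)
    }

corollary4p5 : ∀ (n : ℕ) (G : Graph (suc n)) → Connected G →
    ∃[ m ] Σ (Graph m) λ H → GlobalAmoeba H × HasComponentIso H G
corollary4p5 n G connected =
  _ , H , telescope-globalAmoeba (suc n F.↑ʳ F.zero) (suc n F.↑ʳ F.suc F.zero) K₂-edge ,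
  component connected (componentEmbedding-∘ (⊕-left G K₂) lastLayer-embedding)
  where
    -- Q = G ⊕ K₂ has an edge even when G has none.
    open Telescope (G ⊕ K₂)

    K₂-edge : adj (G ⊕ K₂) (suc n F.↑ʳ F.zero) (suc n F.↑ʳ F.suc F.zero) ≡ true
    K₂-edge = ⊕-right G K₂ F.zero (F.suc F.zero)
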